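{- Let $T$ be a plane tree with at least one internal node and $T'=\mathrm{swap}(T)$ its lodestar swap. Then $\mathrm{lthorn}(T)=\mathrm{lthorn}(T')$ and $\mathrm{rthorn}(T)=\mathrm{rthorn}(T')$.
   Context: A plane tree is a rooted tree with the children of each node ordered left to right; internal nodes have at least one child, leaves have none. Order the internal nodes by preorder (left-to-right contour walk from the root, at first visit). The left lodestar (resp. right lodestar) of $T$ is the first (resp. last) internal node in this order all of whose children are leaves; they may coincide. The lodestar swap $\mathrm{swap}(T)$ is the tree obtained from $T$ by exchanging the positions of the left and right lodestars (each together with its leaf children). For an internal node $u$, an edge $e$ is a left (resp. right) thorn of $u$ if there is an ancestor $v\ne u$ of $u$ such that $e$ joins $v$ to a child of $v$ lying strictly to the left (resp. right) of the child of $v$ on the path from $v$ to $u$. $\mathrm{lthorn}(u)$, $\mathrm{rthorn}(u)$ count these, and $\mathrm{lthorn}(T)$, $\mathrm{rthorn}(T)$ are the sums over all internal nodes. -}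

module Defs where

open import Data.Nat using (ℕ; zero; suc; _+_)
open import Data.Bool using (Bool; true; false; _∧_)
open import Data.List using (List; []; _∷_; _++_; map; length; take; drop; head; last)
open import Data.Nat.ListAction using (sum)
open import Data.Maybe using (Maybe; just; nothing)
open import Relation.Nullary using (¬_)
open import Relation.Binary.PropositionalEquality using (_≡_)

data Tree : Set where
  node : List Tree → Tree

leaf : Tree
leaf = node []

-- T has at least one internal node iff its root is internal.
IsInternal : Tree → Set
IsInternal (node ts) = ¬ (ts ≡ [])

-- Positions of nodes: paths of child indices (0-based, left to right) from the root.
Path : Set
Path = List ℕ

isLeaf : Tree → Bool
isLeaf (node []) = true
isLeaf (node (_ ∷ _)) = false

allLeaves : List Tree → Bool
allLeaves [] = true
allLeaves (t ∷ ts) = isLeaf t ∧ allLeaves ts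

allChildrenLeaves : Tree → Bool
allChildrenLeaves (node []) = false
allChildrenLeaves (node (t ∷ ts)) = allLeaves (t ∷ ts)

mutual
  internals : Tree → List Path
  internals (node []) = []
  internals (node (t ∷ ts)) = [] ∷ internalsFrom 0 (t ∷ ts)

  internalsFrom : ℕ → List Tree → List Path
  internalsFrom i [] = []
  internalsFrom i (t ∷ ts) = map (i ∷_) (internals t) ++ internalsFrom (suc i) ts

mutual
  subtree : Tree → Path → Maybe Tree
  subtree t [] = just t
  subtree (node ts) (i ∷ p) = subtreeAt ts i p

  subtreeAt : List Tree → ℕ → Path → Maybe Tree
  subtreeAt [] _ _ = nothing
  subtreeAt (t ∷ ts) zero p = subtree t p
  subtreeAt (t ∷ ts) (suc i) p = subtreeAt ts i p

mutual
  replace : Tree → Path → Tree → Tree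
  replace t [] s = s
  replace (node ts) (i ∷ p) s = node (replaceAt ts i p s)

  replaceAt : List Tree → ℕ → Path → Tree → List Tree
  replaceAt [] _ _ _ = []
  replaceAt (t ∷ ts) zero p s = replace t p s ∷ ts
  replaceAt (t ∷ ts) (suc i) p s = t ∷ replaceAt ts i p s

isLodestarPos : Tree → Path → Bool
isLodestarPos T p with subtree T p
... | just u = allChildrenLeaves u
... | nothing = false

filterB : {A : Set} → (A → Bool) → List A → List A
filterB f [] = []
filterB f (x ∷ xs) with f x
... | true = x ∷ filterB f xs
... | false = filterB f xs

lodestarCandidates : Tree → List Path
lodestarCandidates T = filterB (isLodestarPos T) (internals T)

leftLodestar : Tree → Maybe Path
leftLodestar T = head (lodestarCandidates T)

rightLodestar : Tree → Maybe Path
rightLodestar T = last (lodestarCandidates T)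

-- exchange the subtrees rooted at the two lodestars
-- (the fallback clauses never fire for a tree with an internal node)
swap : Tree → Tree
swap T with leftLodestar T | rightLodestar T
... | just p | just q with subtree T p | subtree T q
...   | just a | just b = replace (replace T p b) q a
...   | _ | _ = T
swap T | _ | _ = T

mutual
  lthornAt : Tree → Path → ℕ
  lthornAt (node ts) [] = 0
  lthornAt (node ts) (i ∷ p) = length (take i ts) + lthornChild ts i p

  lthornChild : List Tree → ℕ → Path → ℕ
  lthornChild [] _ _ = 0
  lthornChild (t ∷ ts) zero p = lthornAt t p
  lthornChild (t ∷ ts) (suc i) p = lthornChild ts i p

mutual
  rthornAt : Tree → Path → ℕ
  rthornAt (node ts) [] = 0
  rthornAt (node ts) (i ∷ p) = length (drop (suc i) ts) + rthornChild ts i p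

  rthornChild : List Tree → ℕ → Path → ℕ
  rthornChild [] _ _ = 0
  rthornChild (t ∷ ts) zero p = rthornAt t p
  rthornChild (t ∷ ts) (suc i) p = rthornChild ts i p

lthorn : Tree → ℕ
lthorn T = sum (map (lthornAt T) (internals T))

rthorn : Tree → ℕ
rthorn T = sum (map (rthornAt T) (internals T))

{-# OPTIONS --safe #-}
-- Both lodestars are flat: internal nodes all of whose children are leaves. The thorn counts
-- of an internal node u depend only on the arities of the proper ancestors of u and on the
-- child indices along the path to u, and a flat subtree has exactly one internal node, its
-- root. Hence replacing flat subtrees by flat subtrees at the same positions changes neither
-- the preorder list of internal positions nor the thorn count at any of them, and the
-- lodestar swap is such a replacement.
module Submission where

open import Defs
open import Data.Bool using (Bool; true; false)
open import Data.List using (List; []; _∷_; [_]; _++_; map; length)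
open import Data.List.Properties
  using (map-++; map-∘; map-cong; map-cong-local; length-take; length-drop)
open import Data.List.Relation.Binary.Pointwise using (Pointwise; []; _∷_; Pointwise-length)
open import Data.List.Relation.Unary.All as All using (All; []; _∷_)
open import Data.List.Relation.Unary.All.Properties using (head⁺; last⁺; ++⁺; map⁺)
open import Data.Maybe using (just; nothing)
import Data.Maybe.Relation.Unary.All as Maybe
open import Data.Nat using (ℕ; zero; suc; _+_; _∸_; _⊓_)
open import Data.Nat.ListAction using (sum)
open import Data.Product using (_×_; _,_)
open import Function using (_∘_)
open import Relation.Binary.PropositionalEquality
  using (_≡_; refl; cong; cong₂; sym; trans; subst; _≗_; module ≡-Reasoning)
open import Relation.Nullary using (¬_)

IsFlat : Tree → Set
IsFlat t = allChildrenLeaves t ≡ true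

infix 4 _≈_

data _≈_ : Tree → Tree → Set where
  flat : ∀ {a b} → IsFlat a → IsFlat b → a ≈ b
  node : ∀ {ts ts'} → Pointwise _≈_ ts ts' → node ts ≈ node ts'

mutual
  ≈-refl : ∀ t → t ≈ t
  ≈-refl (node ts) = node (≋-refl ts)

  ≋-refl : ∀ ts → Pointwise _≈_ ts ts
  ≋-refl [] = []
  ≋-refl (t ∷ ts) = ≈-refl t ∷ ≋-refl ts

flat-allLeaves : ∀ ts → IsFlat (node ts) → allLeaves ts ≡ true
flat-allLeaves (_ ∷ _) isFlat = isFlat

subtreeAt-allLeaves : ∀ ts i p {a} → allLeaves ts ≡ true → subtreeAt ts i p ≡ just a → a ≡ leaf
subtreeAt-allLeaves (node [] ∷ ts) zero [] _ refl = refl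
subtreeAt-allLeaves (node [] ∷ ts) (suc i) p leaves eq = subtreeAt-allLeaves ts i p leaves eq

flat-no-flat-below : ∀ ts i p {a} → IsFlat (node ts) → subtreeAt ts i p ≡ just a → ¬ IsFlat a
flat-no-flat-below ts i p isFlat eq
  rewrite subtreeAt-allLeaves ts i p (flat-allLeaves ts isFlat) eq = λ ()

mutual
  ≈-replace : ∀ {t t'} p {a b} → t ≈ t' → subtree t p ≡ just a → IsFlat a → IsFlat b →
              t ≈ replace t' p b
  ≈-replace [] _ refl fa fb = flat fa fb
  ≈-replace {node ts} (i ∷ p) (flat ft _) eq fa _ with () ← flat-no-flat-below ts i p ft eq fa
  ≈-replace (i ∷ p) (node ts≋ts') eq fa fb = node (≋-replaceAt i p ts≋ts' eq fa fb)

  ≋-replaceAt : ∀ {ts ts'} i p {a b} → Pointwise _≈_ ts ts' → subtreeAt ts i p ≡ just a →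
                IsFlat a → IsFlat b → Pointwise _≈_ ts (replaceAt ts' i p b)
  ≋-replaceAt zero p (t≈t' ∷ ts≋ts') eq fa fb = ≈-replace p t≈t' eq fa fb ∷ ts≋ts'
  ≋-replaceAt (suc i) p (t≈t' ∷ ts≋ts') eq fa fb = t≈t' ∷ ≋-replaceAt i p ts≋ts' eq fa fb

internalsFrom-allLeaves : ∀ i ts → allLeaves ts ≡ true → internalsFrom i ts ≡ []
internalsFrom-allLeaves i [] _ = refl
internalsFrom-allLeaves i (node [] ∷ ts) leaves = internalsFrom-allLeaves (suc i) ts leaves

internals-flat : ∀ t → IsFlat t → internals t ≡ [ [] ]
internals-flat (node ts@(_ ∷ _)) isFlat = cong ([] ∷_) (internalsFrom-allLeaves 0 ts isFlat)

mutual
  internals-cong : ∀ {t t'} → t ≈ t' → internals t ≡ internals t'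
  internals-cong (flat {a} {b} fa fb) = trans (internals-flat a fa) (sym (internals-flat b fb))
  internals-cong (node []) = refl
  internals-cong (node ts≋ts'@(_ ∷ _)) = cong ([] ∷_) (internalsFrom-cong 0 ts≋ts')

  internalsFrom-cong : ∀ {ts ts'} i → Pointwise _≈_ ts ts' → internalsFrom i ts ≡ internalsFrom i ts'
  internalsFrom-cong i [] = refl
  internalsFrom-cong i (t≈t' ∷ ts≋ts') =
    cong₂ _++_ (cong (map (i ∷_)) (internals-cong t≈t')) (internalsFrom-cong (suc i) ts≋ts')

incHead : Path → Path
incHead [] = []
incHead (i ∷ p) = suc i ∷ p

internalsFrom-suc : ∀ i ts → internalsFrom (suc i) ts ≡ map incHead (internalsFrom i ts)
internalsFrom-suc i [] = refl
internalsFrom-suc i (t ∷ ts) = begin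
  map (suc i ∷_) (internals t) ++ internalsFrom (suc (suc i)) ts
    ≡⟨ cong₂ _++_ (map-∘ (internals t)) (internalsFrom-suc (suc i) ts) ⟩
  map incHead (map (i ∷_) (internals t)) ++ map incHead (internalsFrom (suc i) ts)
    ≡⟨ map-++ incHead (map (i ∷_) (internals t)) (internalsFrom (suc i) ts) ⟨
  map incHead (internalsFrom i (t ∷ ts)) ∎
  where open ≡-Reasoning

-- w n i is what an ancestor with n children contributes when the path leaves it by child i.
Weight : Set
Weight = ℕ → ℕ → ℕ

mutual
  thornAt : Weight → Tree → Path → ℕ
  thornAt w (node ts) [] = 0
  thornAt w (node ts) (i ∷ p) = w (length ts) i + thornAtChild w ts i p

  thornAtChild : Weight → List Tree → ℕ → Path → ℕ
  thornAtChild w [] _ _ = 0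
  thornAtChild w (t ∷ ts) zero p = thornAt w t p
  thornAtChild w (t ∷ ts) (suc i) p = thornAtChild w ts i p

thornBelow : Weight → List Tree → Path → ℕ
thornBelow w ts [] = 0
thornBelow w ts (i ∷ p) = thornAtChild w ts i p

thornSum : Weight → Tree → ℕ
thornSum w t = sum (map (thornAt w t) (internals t))

mutual
  thornAt-cong : ∀ w {t t'} → t ≈ t' → All (λ p → thornAt w t p ≡ thornAt w t' p) (internals t)
  thornAt-cong w (flat {node ts} {node _} fa _) rewrite internals-flat (node ts) fa = refl ∷ []
  thornAt-cong w (node []) = []
  thornAt-cong w (node {ts} {ts'} ts≋ts'@(_ ∷ _)) =
    refl ∷ All.map (λ {p} → arity-cong p) (thornBelow-cong w ts≋ts')
    where
    arity-cong : ∀ p → thornBelow w ts p ≡ thornBelow w ts' p →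
                 thornAt w (node ts) p ≡ thornAt w (node ts') p
    arity-cong [] _ = refl
    arity-cong (i ∷ _) below = cong₂ _+_ (cong (λ n → w n i) (Pointwise-length ts≋ts')) below

  thornBelow-cong : ∀ w {ts ts'} → Pointwise _≈_ ts ts' →
                    All (λ p → thornBelow w ts p ≡ thornBelow w ts' p) (internalsFrom 0 ts)
  thornBelow-cong w [] = []
  thornBelow-cong w {t ∷ ts} {t' ∷ ts'} (t≈t' ∷ ts≋ts') rewrite internalsFrom-suc 0 ts =
    ++⁺ (map⁺ (thornAt-cong w t≈t')) (map⁺ (All.map (λ {p} → shift p) (thornBelow-cong w ts≋ts')))
    where
    shift : ∀ p → thornBelow w ts p ≡ thornBelow w ts' p →
            thornBelow w (t ∷ ts) (incHead p) ≡ thornBelow w (t' ∷ ts') (incHead p)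
    shift [] _ = refl
    shift (_ ∷ _) below = below

thornSum-cong : ∀ w {t t'} → t ≈ t' → thornSum w t ≡ thornSum w t'
thornSum-cong w {t} {t'} t≈t' = begin
  sum (map (thornAt w t) (internals t))   ≡⟨ cong sum (map-cong-local (thornAt-cong w t≈t')) ⟩
  sum (map (thornAt w t') (internals t))  ≡⟨ cong (sum ∘ map (thornAt w t')) (internals-cong t≈t') ⟩
  sum (map (thornAt w t') (internals t')) ∎
  where open ≡-Reasoning

leftWeight : Weight
leftWeight n i = i ⊓ n

rightWeight : Weight
rightWeight n i = n ∸ suc i

mutual
  lthornAt-weighted : ∀ t → lthornAt t ≗ thornAt leftWeight t
  lthornAt-weighted (node ts) [] = refl
  lthornAt-weighted (node ts) (i ∷ p) = cong₂ _+_ (length-take i ts) (lthornChild-weighted ts i p)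

  lthornChild-weighted : ∀ ts i p → lthornChild ts i p ≡ thornAtChild leftWeight ts i p
  lthornChild-weighted [] _ _ = refl
  lthornChild-weighted (t ∷ ts) zero p = lthornAt-weighted t p
  lthornChild-weighted (t ∷ ts) (suc i) p = lthornChild-weighted ts i p

mutual
  rthornAt-weighted : ∀ t → rthornAt t ≗ thornAt rightWeight t
  rthornAt-weighted (node ts) [] = refl
  rthornAt-weighted (node ts) (i ∷ p) = cong₂ _+_ (length-drop (suc i) ts) (rthornChild-weighted ts i p)

  rthornChild-weighted : ∀ ts i p → rthornChild ts i p ≡ thornAtChild rightWeight ts i p
  rthornChild-weighted [] _ _ = refl
  rthornChild-weighted (t ∷ ts) zero p = rthornAt-weighted t p
  rthornChild-weighted (t ∷ ts) (suc i) p = rthornChild-weighted ts i p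

lthorn-weighted : ∀ t → lthorn t ≡ thornSum leftWeight t
lthorn-weighted t = cong sum (map-cong (lthornAt-weighted t) (internals t))

rthorn-weighted : ∀ t → rthorn t ≡ thornSum rightWeight t
rthorn-weighted t = cong sum (map-cong (rthornAt-weighted t) (internals t))

all-filterB : ∀ {A : Set} (f : A → Bool) xs → All (λ x → f x ≡ true) (filterB f xs)
all-filterB f [] = []
all-filterB f (x ∷ xs) with f x in fx≡true
... | true = fx≡true ∷ all-filterB f xs
... | false = all-filterB f xs

leftLodestar-isLodestarPos : ∀ {t p} → leftLodestar t ≡ just p → isLodestarPos t p ≡ true
leftLodestar-isLodestarPos {t} eq =
  Maybe.drop-just (subst (Maybe.All _) eq (head⁺ (all-filterB (isLodestarPos t) (internals t))))

rightLodestar-isLodestarPos : ∀ {t p} → rightLodestar t ≡ just p → isLodestarPos t p ≡ true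
rightLodestar-isLodestarPos {t} eq =
  Maybe.drop-just (subst (Maybe.All _) eq (last⁺ (all-filterB (isLodestarPos t) (internals t))))

isLodestarPos-flat : ∀ t p {a} → isLodestarPos t p ≡ true → subtree t p ≡ just a → IsFlat a
isLodestarPos-flat t p lodestar eq with subtree t p
isLodestarPos-flat t p lodestar refl | just a = lodestar

≈-swap : ∀ t → t ≈ swap t
≈-swap t with leftLodestar t in left | rightLodestar t in right
... | just p | just q with subtree t p in at-p | subtree t q in at-q
...   | just a | just b = ≈-replace q (≈-replace p (≈-refl t) at-p fa fb) at-q fb fa
  where
  fa : IsFlat a
  fa = isLodestarPos-flat t p (leftLodestar-isLodestarPos left) at-p
  fb : IsFlat b
  fb = isLodestarPos-flat t q (rightLodestar-isLodestarPos right) at-q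
...   | just _ | nothing = ≈-refl t
...   | nothing | _ = ≈-refl t
≈-swap t | just _ | nothing = ≈-refl t
≈-swap t | nothing | _ = ≈-refl t

proposition4p4 : (T : Tree) → IsInternal T →
    (lthorn T ≡ lthorn (swap T)) × (rthorn T ≡ rthorn (swap T))
proposition4p4 T _ = preserved lthorn-weighted , preserved rthorn-weighted
  where
  open ≡-Reasoning
  preserved : ∀ {thorn : Tree → ℕ} {w} → (∀ t → thorn t ≡ thornSum w t) → thorn T ≡ thorn (swap T)
  preserved {thorn} {w} weighted = begin
    thorn T             ≡⟨ weighted T ⟩
    thornSum w T        ≡⟨ thornSum-cong w (≈-swap T) ⟩
    thornSum w (swap T) ≡⟨ weighted (swap T) ⟨
    thorn (swap T)      ∎
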